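{- Let $\mathcal U,\mathcal V$ be universes. If every $\mathcal V$-covered element of $\mathcal P_{\mathcal U}(\Omega_{\mathcal U})$ is $\mathcal V$-small, then $\mathrm{Propositional\text{ - }Resizing}_{\mathcal U,\mathcal V}$ holds, i.e. every proposition in $\mathcal U$ is $\mathcal V$-small.
   Context: Setting: intensional Martin-Löf type theory with universes, function extensionality, propositional extensionality and propositional truncations. $\Omega_{\mathcal T}$ is the type of propositions in $\mathcal T$; for a type $X$, $\mathcal P_{\mathcal T}(X):=X\to\Omega_{\mathcal T}$ is the type of $\mathcal T$-valued subsets, and the total space of $S$ is $\mathbb T(S):=\Sigma_{x:X}(x\in S)$. A type is $\mathcal V$-small if equivalent to a type in $\mathcal V$. A subset $S$ is $\mathcal V$-small if $\mathbb T(S)$ is $\mathcal V$-small, and $\mathcal V$-covered if there is a type $I:\mathcal V$ with a surjection $I\to\mathbb T(S)$ (a map all of whose fibres are inhabited). -}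

module Defs where

open import Level using (Level; _⊔_; Setω) renaming (suc to lsuc)
open import Data.Product using (Σ; _×_; _,_; proj₁; proj₂)
open import Relation.Binary.PropositionalEquality using (_≡_)

isProp : ∀ {ℓ} → Set ℓ → Set ℓ
isProp P = (x y : P) → x ≡ y

FunExt : Setω
FunExt = ∀ {a b} {A : Set a} {B : A → Set b} {f g : (x : A) → B x}
       → ((x : A) → f x ≡ g x) → f ≡ g

PropExt : Setω
PropExt = ∀ {ℓ} {P Q : Set ℓ} → isProp P → isProp Q → (P → Q) → (Q → P) → P ≡ Q

record PropTrunc : Setω where
  field
    ∥_∥        : ∀ {ℓ} → Set ℓ → Set ℓ
    ∥∥-isProp  : ∀ {ℓ} {A : Set ℓ} → isProp ∥ A ∥
    ∣_∣        : ∀ {ℓ} {A : Set ℓ} → A → ∥ A ∥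
    ∥∥-rec     : ∀ {ℓ ℓ'} {A : Set ℓ} {Q : Set ℓ'} → isProp Q → (A → Q) → ∥ A ∥ → Q

isEquiv : ∀ {a b} {A : Set a} {B : Set b} → (A → B) → Set (a ⊔ b)
isEquiv {A = A} {B} f =
  (Σ (B → A) λ g → (y : B) → f (g y) ≡ y) × (Σ (B → A) λ h → (x : A) → h (f x) ≡ x)

_≃_ : ∀ {a b} → Set a → Set b → Set (a ⊔ b)
A ≃ B = Σ (A → B) isEquiv

isSmall : ∀ {a} (𝓥 : Level) → Set a → Set (a ⊔ lsuc 𝓥)
isSmall 𝓥 X = Σ (Set 𝓥) λ Y → Y ≃ X

Ω : (𝓤 : Level) → Set (lsuc 𝓤)
Ω 𝓤 = Σ (Set 𝓤) isProp

𝒫 : ∀ {a} (𝓤 : Level) → Set a → Set (a ⊔ lsuc 𝓤)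
𝒫 𝓤 X = X → Ω 𝓤

_∈_ : ∀ {a 𝓤} {X : Set a} → X → 𝒫 𝓤 X → Set 𝓤
x ∈ S = proj₁ (S x)

𝕋 : ∀ {a 𝓤} {X : Set a} → 𝒫 𝓤 X → Set (a ⊔ 𝓤)
𝕋 {X = X} S = Σ X λ x → x ∈ S

module _ (pt : PropTrunc) where
  open PropTrunc pt

  fiber : ∀ {a b} {A : Set a} {B : Set b} → (A → B) → B → Set (a ⊔ b)
  fiber {A = A} f y = Σ A λ x → f x ≡ y

  isSurjection : ∀ {a b} {A : Set a} {B : Set b} → (A → B) → Set (a ⊔ b)
  isSurjection {B = B} f = (y : B) → ∥ fiber f y ∥

  isCovered : ∀ {a 𝓤} (𝓥 : Level) {X : Set a} → 𝒫 𝓤 X → Set (a ⊔ 𝓤 ⊔ lsuc 𝓥)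
  isCovered 𝓥 S = Σ (Set 𝓥) λ I → Σ (I → 𝕋 S) λ f → isSurjection f

isSmallSubset : ∀ {a 𝓤} (𝓥 : Level) {X : Set a} → 𝒫 𝓤 X → Set (a ⊔ 𝓤 ⊔ lsuc 𝓥)
isSmallSubset 𝓥 S = isSmall 𝓥 (𝕋 S)

PropositionalResizing : (𝓤 𝓥 : Level) → Set (lsuc 𝓤 ⊔ lsuc 𝓥)
PropositionalResizing 𝓤 𝓥 = (P : Set 𝓤) → isProp P → isSmall 𝓥 P

-- The doubleton {⊤, P} ⊆ Ω 𝓤 is covered by a two-element type in 𝓥, so by
-- hypothesis its total space is equivalent to some Y : 𝓥. P holds exactly when
-- the two points ⊤ and P of the doubleton are equal, and equality of two points
-- of a 𝓥-small type can be tested, up to truncation, inside 𝓥.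
module Submission where

open import Defs
open import Level using (Level; Lift; lift)
open import Data.Product using (_,_; proj₁; proj₂)
open import Data.Sum using (_⊎_; inj₁; inj₂)
open import Data.Unit.Polymorphic using (⊤; tt)
open import Data.Bool using (Bool; true; false)
open import Function using (id; _∘_; _⇔_; mk⇔; Equivalence)
open import Relation.Binary.PropositionalEquality using (_≡_; refl; sym; trans; cong; subst)
open import Axiom.UniquenessOfIdentityProofs using (UIP; module Constant⇒UIP)

private
  variable
    a b : Level
    A : Set a
    B : Set b

isProp⇒UIP : isProp A → UIP A
isProp⇒UIP p = Constant⇒UIP.≡-irrelevant (λ {x} {y} _ → trans (sym (p x x)) (p x y)) (λ _ _ → refl)

isProp-isProp : FunExt → isProp (isProp A)
isProp-isProp fe p q = fe λ x → fe λ y → isProp⇒UIP p (p x y) (q x y)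

Σ-≡-isProp : {B : A → Set b} → (∀ x → isProp (B x))
           → {x x' : A} {y : B x} {y' : B x'} → x ≡ x' → (x , y) ≡ (x' , y')
Σ-≡-isProp isProp-B {x} {y = y} {y'} refl = cong (x ,_) (isProp-B x y y')

Ω-ext : FunExt → PropExt → ∀ {𝓤} (P Q : Ω 𝓤) → (proj₁ P → proj₁ Q) → (proj₁ Q → proj₁ P) → P ≡ Q
Ω-ext fe pe (P , pP) (Q , pQ) f g = Σ-≡-isProp (λ _ → isProp-isProp fe) (pe pP pQ f g)

𝕋-≡ : ∀ {𝓤} {X : Set a} (S : 𝒫 𝓤 X) {u v : 𝕋 S} → proj₁ u ≡ proj₁ v → u ≡ v
𝕋-≡ S = Σ-≡-isProp (λ x → proj₂ (S x))

≃-isProp : A ≃ B → isProp B → isProp A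
≃-isProp (f , _ , h , hf) pB x y = trans (sym (hf x)) (trans (cong h (pB (f x) (f y))) (hf y))

isProp-⇔⇒≃ : isProp A → isProp B → (A → B) → (B → A) → A ≃ B
isProp-⇔⇒≃ pA pB f g = f , (g , λ _ → pB _ _) , (g , λ _ → pA _ _)

isSmall-⇔ : ∀ 𝓥 → isProp A → isProp B → (A → B) → (B → A) → isSmall 𝓥 A → isSmall 𝓥 B
isSmall-⇔ 𝓥 pA pB f g (Y , e) = Y , isProp-⇔⇒≃ (≃-isProp e pA) pB (f ∘ proj₁ e) (proj₁ (proj₁ (proj₂ e)) ∘ g)

module _ (pt : PropTrunc) where
  open PropTrunc pt

  ∥≡∥-isSmall : ∀ 𝓥 {X : Set a} → isSmall 𝓥 X → (x y : X) → isSmall 𝓥 ∥ x ≡ y ∥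
  ∥≡∥-isSmall 𝓥 (Y , e , (g , e∘g) , _) x y =
    ∥ g x ≡ g y ∥ , isProp-⇔⇒≃ ∥∥-isProp ∥∥-isProp
      (∥∥-rec ∥∥-isProp λ q → ∣ trans (sym (e∘g x)) (trans (cong e q) (e∘g y)) ∣)
      (∥∥-rec ∥∥-isProp λ q → ∣ cong g q ∣)

  module Doubleton (fe : FunExt) (pe : PropExt) {𝓤} (P : Ω 𝓤) where

    ⊤Ω : Ω 𝓤
    ⊤Ω = ⊤ , λ _ _ → refl

    ⊤-or-P : 𝒫 𝓤 (Ω 𝓤)
    ⊤-or-P (Q , _) = ∥ Q ⊎ (Q ⇔ proj₁ P) ∥ , ∥∥-isProp

    ⊤-point P-point : 𝕋 ⊤-or-P
    ⊤-point = ⊤Ω , ∣ inj₁ tt ∣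
    P-point = P , ∣ inj₂ (mk⇔ id id) ∣

    pick : ∀ {𝓥} → Lift 𝓥 Bool → 𝕋 ⊤-or-P
    pick (lift true)  = ⊤-point
    pick (lift false) = P-point

    pick-isSurjection : ∀ {𝓥} → isSurjection pt (pick {𝓥})
    pick-isSurjection (Q , Q∈) = ∥∥-rec ∥∥-isProp preimage Q∈
      where
      preimage : proj₁ Q ⊎ (proj₁ Q ⇔ proj₁ P) → ∥ fiber pt pick (Q , Q∈) ∥
      preimage (inj₁ q)   = ∣ lift true , 𝕋-≡ ⊤-or-P (Ω-ext fe pe ⊤Ω Q (λ _ → q) (λ _ → tt)) ∣
      preimage (inj₂ Q⇔P) = ∣ lift false , 𝕋-≡ ⊤-or-P (Ω-ext fe pe P Q (Equivalence.from Q⇔P) (Equivalence.to Q⇔P)) ∣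

    ⊤-or-P-isCovered : ∀ 𝓥 → isCovered pt 𝓥 ⊤-or-P
    ⊤-or-P-isCovered 𝓥 = Lift 𝓥 Bool , pick , pick-isSurjection

    holds⇒⊤≡P : proj₁ P → ∥ ⊤-point ≡ P-point ∥
    holds⇒⊤≡P x = ∣ 𝕋-≡ ⊤-or-P (Ω-ext fe pe ⊤Ω P (λ _ → x) (λ _ → tt)) ∣

    ⊤≡P⇒holds : ∥ ⊤-point ≡ P-point ∥ → proj₁ P
    ⊤≡P⇒holds = ∥∥-rec (proj₂ P) λ q → subst id (cong (proj₁ ∘ proj₁) q) tt

mainTheorem17 : FunExt → PropExt → (pt : PropTrunc) → (𝓤 𝓥 : Level)
    → ((S : 𝒫 𝓤 (Ω 𝓤)) → isCovered pt 𝓥 S → isSmallSubset 𝓥 S)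
    → PropositionalResizing 𝓤 𝓥
mainTheorem17 fe pe pt 𝓤 𝓥 covered⇒small P pP =
  isSmall-⇔ 𝓥 ∥∥-isProp pP ⊤≡P⇒holds holds⇒⊤≡P
    (∥≡∥-isSmall pt 𝓥 (covered⇒small ⊤-or-P (⊤-or-P-isCovered 𝓥)) _ _)
  where
  open PropTrunc pt
  open Doubleton pt fe pe (P , pP)
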